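{- Let $F$ be a clause-set, $V\subseteq\mathrm{var}(F)$, and let $P$ be the set of partial assignments $\psi$ with $\mathrm{var}(\psi)=V$. Then $\mathrm{hd}(F)\le|V|+\max_{\psi\in P}\mathrm{hd}(\psi*F)$.
   Context: Literals are variables $v$ or negations $\overline{v}$; clauses finite sets of literals without complementary pair; clause-sets finite sets of clauses; $\bot$ empty clause, $\top$ empty clause-set; $\mathrm{var}(F)$ variables of $F$. A partial assignment $\varphi$ maps a finite variable set $\mathrm{var}(\varphi)$ to $\{0,1\}$; $\varphi*F$ removes satisfied clauses and false literals; $F$ unsatisfiable if no $\varphi$ gives $\varphi*F=\top$. Resolution: $C,D$ with exactly one clash $x\in C,\overline{x}\in D$ have resolvent $(C\cup D)\setminus\{x,\overline{x}\}$. Resolution tree: finite rooted tree, inner nodes with two children, labelled by clauses, inner labels resolvents of children's labels; refutation of $F$: leaves in $F$, root $\bot$. Horton–Strahler number: $0$ for one node; for root subtrees $T_1,T_2$: $\mathrm{hts}(T_1)+1$ if equal, else the maximum. For unsatisfiable $F$, $\mathrm{hd}(F)$ is the minimum Horton–Strahler number of a refutation. Extension: $\mathrm{hd}(\top)=0$; for $F\neq\top$, $\mathrm{hd}(F)=\max\{\mathrm{hd}(\varphi*F):\varphi*F\text{ unsatisfiable}\}$. -}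

module Defs where

open import Data.Nat using (ℕ; zero; suc; _≤_; _≡ᵇ_; _⊔_)
open import Data.Nat.Properties using (_≟_)
open import Data.Bool using (Bool; true; false; not; if_then_else_; _∧_)
open import Data.Maybe using (Maybe; just; nothing)
open import Data.List using (List; []; _∷_; map; filterᵇ)
open import Data.Bool.ListAction using (any)
open import Data.Empty using (⊥)
open import Data.List.Membership.Propositional using (_∈_)
open import Data.List.Relation.Unary.Unique.Propositional using (Unique)
open import Data.Product using (Σ; Σ-syntax; ∃; ∃-syntax; _×_; _,_; proj₁)
open import Data.Sum using (_⊎_)
open import Relation.Nullary using (¬_; does)
open import Relation.Binary.PropositionalEquality using (_≡_; _≢_)
open import Function.Bundles using (_⇔_)

-- Variables are natural numbers; a literal is a variable with a sign
-- (sign true = positive literal v, sign false = negative literal v̄).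
record Lit : Set where
  constructor lit
  field
    var  : ℕ
    sign : Bool
open Lit public

neg : Lit → Lit
neg (lit v s) = lit v (not s)

-- Clauses and clause-sets are represented by lists, read as finite sets
-- (all notions below only use membership).
Clause : Set
Clause = List Lit

ClauseSet : Set
ClauseSet = List Clause

ClashFree : Clause → Set
ClashFree C = ∀ l → l ∈ C → neg l ∈ C → ⊥

IsClauseSet : ClauseSet → Set
IsClauseSet F = ∀ C → C ∈ F → ClashFree C

_≈ᶜ_ : Clause → Clause → Set
C ≈ᶜ D = ∀ l → (l ∈ C) ⇔ (l ∈ D)

_∈ᶜ_ : Clause → ClauseSet → Set
C ∈ᶜ F = ∃[ D ] (D ∈ F × C ≈ᶜ D)

_∈var_ : ℕ → ClauseSet → Set
v ∈var F = ∃[ C ] (C ∈ F × ∃[ l ] (l ∈ C × var l ≡ v))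

Assign : Set
Assign = List (ℕ × Bool)

dom : Assign → List ℕ
dom = map proj₁

IsAssign : Assign → Set
IsAssign φ = Unique (dom φ)

look : Assign → ℕ → Maybe Bool
look [] v = nothing
look ((w , b) ∷ φ) v = if does (v ≟ w) then just b else look φ v

eqB : Bool → Bool → Bool
eqB true true = true
eqB false false = true
eqB _ _ = false

litSat : Assign → Lit → Bool
litSat φ l with look φ (var l)
... | just b = eqB b (sign l)
... | nothing = false

litUnassigned : Assign → Lit → Bool
litUnassigned φ l with look φ (var l)
... | just _ = false
... | nothing = true

_*_ : Assign → ClauseSet → ClauseSet
φ * [] = []
φ * (C ∷ F) =
  if any (litSat φ) C
  then φ * F
  else filterᵇ (litUnassigned φ) C ∷ (φ * F)

Unsat : ClauseSet → Set
Unsat F = ∀ φ → IsAssign φ → ¬ (φ * F ≡ [])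

Resolvent : Clause → Clause → Clause → Set
Resolvent C D R =
  Σ[ x ∈ Lit ] (x ∈ C × neg x ∈ D
    × (∀ y → y ∈ C → neg y ∈ D → y ≡ x)
    × (∀ l → (l ∈ R) ⇔ ((l ∈ C ⊎ l ∈ D) × l ≢ x × l ≢ neg x)))

data RTree (F : ClauseSet) : Clause → Set where
  leaf : ∀ {C} → C ∈ᶜ F → RTree F C
  node : ∀ {C D R} → RTree F C → RTree F D → Resolvent C D R → RTree F R

hts : ∀ {F C} → RTree F C → ℕ
hts (leaf _) = 0
hts (node T₁ T₂ _) =
  if hts T₁ ≡ᵇ hts T₂ then suc (hts T₁) else hts T₁ ⊔ hts T₂

Refutation : ClauseSet → Set
Refutation F = RTree F []

-- hd(F) ≤ k :
--  * for unsatisfiable F: some refutation has Horton–Strahler number ≤ k;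
--  * for satisfiable F (extension; includes F = ⊤ vacuously):
--    hd(φ * F) ≤ k for every φ with φ * F unsatisfiable.
HdLe : ClauseSet → ℕ → Set
HdLe F k =
  (Unsat F → Σ[ T ∈ Refutation F ] hts T ≤ k)
  × (¬ Unsat F → ∀ φ → IsAssign φ → Unsat (φ * F)
       → Σ[ T ∈ Refutation (φ * F) ] hts T ≤ k)

-- Fix φ with φ * F unsatisfiable and let W be the variables of V left free by φ; we split on W.
-- Undoing an assignment v ↦ b turns a refutation of the reduct by v ↦ b into a derivation of ⊥ or
-- of the unit clause that v ↦ b falsifies, and resolving the two unit clauses obtained for b = 0
-- and b = 1 costs at most one Horton–Strahler level. So φ * F has a refutation of Horton–Strahler
-- number at most |W| + k ≤ |V| + k once every leaf θ of the splitting, which assigns all of V, has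
-- one of number at most k. For such θ we have θ * F = θ * (ψ * F) with ψ the restriction of θ to V,
-- and hd(ψ * F) ≤ k: if ψ * F is unsatisfiable, restricting its refutation by θ does not increase
-- the Horton–Strahler number; otherwise the extended definition of hd applies directly. This case
-- distinction is decidable since only the finitely many assignments to var(F) matter.

module Submission where

open import Defs
open import Data.Nat using (ℕ; suc; _+_; _≤_; _⊔_; _≡ᵇ_; z≤n; s≤s)
open import Data.Nat.Properties
  using ( _≟_; ≤-reflexive; ≤-trans; ≤-antisym; n≤1+n; m≤m⊔n; m≤n⊔m; ⊔-lub; ⊔-mono-≤
        ; m⊔n≤o⇒m≤o; m⊔n≤o⇒n≤o; ≰⇒>; +-monoˡ-≤)
open import Data.Bool using (Bool; true; false; not; T; _∨_; if_then_else_) renaming (_≟_ to _≟ᵇ_)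
open import Data.Bool.Properties using (T?; T-≡; T-∨; not-involutive; not-¬)
open import Data.Bool.ListAction using (any)
open import Data.Maybe using (just; nothing; fromMaybe)
open import Data.Maybe.Properties using (just-injective) renaming (≡-dec to ≡-dec-Maybe)
open import Data.List using (List; []; _∷_; map; filter; filterᵇ; _++_; length; deduplicate)
open import Data.List.Properties using (map-++; ≡-dec; length-filter)
open import Data.List.Membership.Propositional using (_∈_; _∉_; find; lose)
open import Data.List.Membership.Propositional.Properties
  using (∈-filter⁺; ∈-filter⁻; ∈-++⁺ˡ; ∈-++⁺ʳ; ∈-++⁻; ∈-map⁺; ∈-map⁻; ∈-deduplicate⁺)
open import Data.List.Relation.Binary.Subset.Propositional using (_⊆_)
open import Data.List.Relation.Unary.Any using (here; there; any?)
open import Data.List.Relation.Unary.Any.Properties using (any⁺; any⁻)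
open import Data.List.Relation.Unary.All as All using (All; []; _∷_)
open import Data.List.Relation.Unary.All.Properties using (¬Any⇒All¬; all-filter)
open import Data.List.Relation.Unary.Unique.Propositional using (Unique)
import Data.List.Relation.Unary.Unique.Propositional.Properties as Unique
open import Data.List.Relation.Binary.Disjoint.Propositional using (Disjoint)
open import Data.List.Relation.Unary.Unique.DecPropositional.Properties _≟_ using (deduplicate-!)
open import Data.List.Relation.Unary.AllPairs using ([]; _∷_)
open import Data.Product using (Σ-syntax; ∃-syntax; _×_; _,_; proj₁; proj₂)
open import Data.Sum using (_⊎_; inj₁; inj₂; [_,_]′)
open import Data.Empty using (⊥; ⊥-elim)
open import Function using (_∘_)
open import Function.Bundles using (_⇔_; mk⇔; Equivalence)
open import Relation.Binary.Definitions using (DecidableEquality)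
open import Relation.Binary.PropositionalEquality
open import Relation.Nullary using (Dec; yes; no; does)
open import Relation.Nullary.Decidable using (dec-true; dec-false; ¬?; _×-dec_)

open Equivalence

_≟ˡ_ : DecidableEquality Lit
lit v s ≟ˡ lit w t with v ≟ w | s ≟ᵇ t
... | yes refl | yes refl = yes refl
... | no v≢w   | _        = no λ { refl → v≢w refl }
... | yes _    | no s≢t   = no λ { refl → s≢t refl }

open import Data.List.Membership.DecPropositional _≟ˡ_ using (_∈?_)

neg-involutive : ∀ l → neg (neg l) ≡ l
neg-involutive (lit v true)  = refl
neg-involutive (lit v false) = refl

neg-≢ : ∀ l → neg l ≢ l
neg-≢ (lit v true)  ()
neg-≢ (lit v false) ()

-- Partial assignments

look-here : ∀ v b φ → look ((v , b) ∷ φ) v ≡ just b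
look-here v b φ rewrite dec-true (v ≟ v) refl = refl

look-there : ∀ {u v} b φ → u ≢ v → look ((v , b) ∷ φ) u ≡ look φ u
look-there {u} {v} b φ u≢v rewrite dec-false (u ≟ v) u≢v = refl

Unassigned : Assign → ℕ → Set
Unassigned φ v = look φ v ≡ nothing

Assigned : Assign → ℕ → Set
Assigned φ v = ∃[ c ] look φ v ≡ just c

record _⊑_ (φ θ : Assign) : Set where
  constructor extends
  field look-⊑ : ∀ v c → look φ v ≡ just c → look θ v ≡ just c
open _⊑_

⊑-refl : ∀ {φ} → φ ⊑ φ
⊑-refl = extends λ _ _ set → set

⊑-trans : ∀ {φ χ θ} → φ ⊑ χ → χ ⊑ θ → φ ⊑ θ
⊑-trans φ⊑χ χ⊑θ = extends λ v c → look-⊑ χ⊑θ v c ∘ look-⊑ φ⊑χ v c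

unassigned-≢ : ∀ φ {u v c} → Unassigned φ u → look φ v ≡ just c → u ≢ v
unassigned-≢ φ u-free v-set refl with () ← trans (sym u-free) v-set

assigned⇒∈dom : ∀ φ {v c} → look φ v ≡ just c → v ∈ dom φ
assigned⇒∈dom ((u , b) ∷ φ) {v} set with v ≟ u
... | yes v≡u = here v≡u
... | no  v≢u = there (assigned⇒∈dom φ (trans (sym (look-there b φ v≢u)) set))

++-⊑ : ∀ φ χ → φ ⊑ (φ ++ χ)
++-⊑ φ χ = extends (look-++ˡ φ)
  where
    look-++ˡ : ∀ φ v c → look φ v ≡ just c → look (φ ++ χ) v ≡ just c
    look-++ˡ ((u , b) ∷ φ) v c set with v ≡ᵇ u
    ... | true  = set
    ... | false = look-++ˡ φ v c set

look-++ʳ : ∀ φ χ {v} → Unassigned φ v → look (φ ++ χ) v ≡ look χ v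
look-++ʳ []            χ     _      = refl
look-++ʳ ((u , b) ∷ φ) χ {v} v-free with v ≡ᵇ u
look-++ʳ ((u , b) ∷ φ) χ v-free | false = look-++ʳ φ χ v-free
look-++ʳ ((u , b) ∷ φ) χ ()     | true

∷-⊑ : ∀ {χ v} b → Unassigned χ v → χ ⊑ ((v , b) ∷ χ)
∷-⊑ {χ} b v-free =
  extends λ u c u-set → trans (look-there b χ (unassigned-≢ χ v-free u-set ∘ sym)) u-set

∷-unassigned : ∀ {v} u c φ → Unassigned ((u , c) ∷ φ) v → v ≢ u × Unassigned φ v
∷-unassigned u c φ v-free = v≢u , trans (sym (look-there c φ v≢u)) v-free
  where
    v≢u = unassigned-≢ ((u , c) ∷ φ) v-free (look-here u c φ)

unassigned⇒∉dom : ∀ φ {v} → Unassigned φ v → v ∉ dom φ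
unassigned⇒∉dom ((u , c) ∷ φ) v-free (here v≡u) = proj₁ (∷-unassigned u c φ v-free) v≡u
unassigned⇒∉dom ((u , c) ∷ φ) v-free (there v∈) =
  unassigned⇒∉dom φ (proj₂ (∷-unassigned u c φ v-free)) v∈

∷-IsAssign : ∀ {χ v} b → Unassigned χ v → IsAssign χ → IsAssign ((v , b) ∷ χ)
∷-IsAssign {χ} b v-free χ-assign = ¬Any⇒All¬ (dom χ) (unassigned⇒∉dom χ v-free) ∷ χ-assign

Unassigned? : ∀ φ v → Dec (Unassigned φ v)
Unassigned? φ v = ≡-dec-Maybe _≟ᵇ_ (look φ v) nothing

value : Assign → ℕ → Bool
value φ v = fromMaybe false (look φ v)

value-assigned : ∀ φ {v c} → look φ v ≡ just c → value φ v ≡ c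
value-assigned φ set rewrite set = refl

infix 25 _↾_

_↾_ : Assign → List ℕ → Assign
φ ↾ V = map (λ v → v , value φ v) V

dom-↾ : ∀ φ V → dom (φ ↾ V) ≡ V
dom-↾ φ []      = refl
dom-↾ φ (v ∷ V) = cong (v ∷_) (dom-↾ φ V)

look-↾ : ∀ φ V {v} → v ∈ V → look (φ ↾ V) v ≡ just (value φ v)
look-↾ φ (w ∷ V) {v} v∈ with v ≟ w
look-↾ φ (w ∷ V) v∈          | yes refl = look-here w (value φ w) (φ ↾ V)
look-↾ φ (w ∷ V) (here v≡w)  | no v≢w   = ⊥-elim (v≢w v≡w)
look-↾ φ (w ∷ V) (there v∈)  | no v≢w   =
  trans (look-there (value φ w) (φ ↾ V) v≢w) (look-↾ φ V v∈)

↾-⊑ : ∀ θ V → All (Assigned θ) V → (θ ↾ V) ⊑ θ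
↾-⊑ θ V V-assigned = extends λ v c set →
  let v∈V       = subst (v ∈_) (dom-↾ θ V) (assigned⇒∈dom (θ ↾ V) set)
      c′ , θ-at-v = All.lookup V-assigned v∈V
  in begin
    look θ v          ≡⟨ θ-at-v ⟩
    just c′           ≡⟨ cong just (value-assigned θ θ-at-v) ⟨
    just (value θ v)  ≡⟨ look-↾ θ V v∈V ⟨
    look (θ ↾ V) v    ≡⟨ set ⟩
    just c            ∎
  where open ≡-Reasoning

eqB⇒≡ : ∀ c s → eqB c s ≡ true → c ≡ s
eqB⇒≡ true  true  _ = refl
eqB⇒≡ false false _ = refl

eqB-refl : ∀ s → eqB s s ≡ true
eqB-refl true  = refl
eqB-refl false = refl

eqB-not : ∀ s → eqB (not s) s ≡ false
eqB-not true  = refl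
eqB-not false = refl

eqB-false⇒≡not : ∀ c s → eqB c s ≡ false → c ≡ not s
eqB-false⇒≡not true  false _ = refl
eqB-false⇒≡not false true  _ = refl

litSat⇒look : ∀ φ l → litSat φ l ≡ true → look φ (var l) ≡ just (sign l)
litSat⇒look φ l sat with look φ (var l)
litSat⇒look φ l sat | just c  = cong just (eqB⇒≡ c (sign l) sat)
litSat⇒look φ l ()  | nothing

look⇒litSat : ∀ φ l → look φ (var l) ≡ just (sign l) → litSat φ l ≡ true
look⇒litSat φ l eq rewrite eq = eqB-refl (sign l)

look⇒litSat-false : ∀ φ l → look φ (var l) ≡ just (not (sign l)) → litSat φ l ≡ false
look⇒litSat-false φ l eq rewrite eq = eqB-not (sign l)

litSat-false⇒≡not : ∀ φ l {c} → look φ (var l) ≡ just c → litSat φ l ≡ false → sign l ≡ not c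
litSat-false⇒≡not φ l {c} eq unsat rewrite eq =
  trans (sym (not-involutive (sign l))) (cong not (sym (eqB-false⇒≡not c (sign l) unsat)))

litUnassigned⇒look : ∀ φ l → litUnassigned φ l ≡ true → Unassigned φ (var l)
litUnassigned⇒look φ l free with look φ (var l)
litUnassigned⇒look φ l free | nothing = refl
litUnassigned⇒look φ l ()   | just _

look⇒litUnassigned : ∀ φ l → Unassigned φ (var l) → litUnassigned φ l ≡ true
look⇒litUnassigned φ l eq rewrite eq = refl

litFalsified⇒look : ∀ φ l → litSat φ l ≡ false → litUnassigned φ l ≡ false
                  → look φ (var l) ≡ just (not (sign l))
litFalsified⇒look φ l unsat set with look φ (var l)
litFalsified⇒look φ l unsat set | just c  = cong just (eqB-false⇒≡not c (sign l) unsat)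
litFalsified⇒look φ l unsat ()  | nothing

⊑-litSat : ∀ {φ θ} → φ ⊑ θ → ∀ l → litSat φ l ≡ true → litSat θ l ≡ true
⊑-litSat {φ} {θ} φ⊑θ l sat = look⇒litSat θ l (look-⊑ φ⊑θ (var l) (sign l) (litSat⇒look φ l sat))

⊑-litUnassigned : ∀ {φ θ} → φ ⊑ θ → ∀ l → litUnassigned θ l ≡ true → litUnassigned φ l ≡ true
⊑-litUnassigned {φ} {θ} φ⊑θ l free with look φ (var l) in eq
... | nothing = refl
... | just c with () ← trans (sym (litUnassigned⇒look θ l free)) (look-⊑ φ⊑θ (var l) c eq)

⊑-litFalsified : ∀ {ψ θ} → ψ ⊑ θ → ∀ l → litSat ψ l ≡ false → litUnassigned ψ l ≡ false
               → litSat θ l ≡ false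
⊑-litFalsified {ψ} {θ} ψ⊑θ l unsat set =
  look⇒litSat-false θ l (look-⊑ ψ⊑θ (var l) _ (litFalsified⇒look ψ l unsat set))

↾-litSat : ∀ φ V {l} → var l ∈ V → litSat φ l ≡ true → litSat (φ ↾ V) l ≡ true
↾-litSat φ V {l} l-in-V l-sat = look⇒litSat (φ ↾ V) l (begin
  look (φ ↾ V) (var l)    ≡⟨ look-↾ φ V l-in-V ⟩
  just (value φ (var l))  ≡⟨ cong just (value-assigned φ (litSat⇒look φ l l-sat)) ⟩
  just (sign l)           ∎)
  where open ≡-Reasoning

litSat-neg : ∀ θ x → litSat θ x ≡ true → litSat θ (neg x) ≡ true → ⊥
litSat-neg θ x x-sat ¬x-sat =
  not-¬ refl (just-injective (trans (sym (litSat⇒look θ x x-sat)) (litSat⇒look θ (neg x) ¬x-sat)))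

-- Reducts

module _ {A : Set} (p : A → Bool) where

  any-true⁻ : ∀ xs → any p xs ≡ true → ∃[ x ] (x ∈ xs × p x ≡ true)
  any-true⁻ xs holds with x , x∈xs , px ← find (any⁻ p xs (from T-≡ holds)) = x , x∈xs , to T-≡ px

  any-true⁺ : ∀ {xs x} → x ∈ xs → p x ≡ true → any p xs ≡ true
  any-true⁺ x∈xs px = to T-≡ (any⁺ p (lose x∈xs (from T-≡ px)))

  any-false⁻ : ∀ {xs x} → any p xs ≡ false → x ∈ xs → p x ≡ false
  any-false⁻ {xs} {x} none x∈xs with p x in px
  ... | false = refl
  ... | true with () ← trans (sym none) (any-true⁺ x∈xs px)

  ∈-filterᵇ⁻ : ∀ {xs x} → x ∈ filterᵇ p xs → x ∈ xs × p x ≡ true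
  ∈-filterᵇ⁻ {xs} x∈ with x∈xs , px ← ∈-filter⁻ (T? ∘ p) {xs = xs} x∈ = x∈xs , to T-≡ px

  ∈-filterᵇ⁺ : ∀ {xs x} → x ∈ xs → p x ≡ true → x ∈ filterᵇ p xs
  ∈-filterᵇ⁺ x∈xs px = ∈-filter⁺ (T? ∘ p) x∈xs (from T-≡ px)

filterᵇ-absorb : ∀ {A : Set} (p q : A → Bool) → (∀ x → q x ≡ true → p x ≡ true)
               → ∀ xs → filterᵇ q (filterᵇ p xs) ≡ filterᵇ q xs
filterᵇ-absorb p q q⇒p [] = refl
filterᵇ-absorb p q q⇒p (x ∷ xs) with p x in px
... | true with q x
...   | true  = cong (x ∷_) (filterᵇ-absorb p q q⇒p xs)
...   | false = filterᵇ-absorb p q q⇒p xs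
filterᵇ-absorb p q q⇒p (x ∷ xs) | false with q x in qx
...   | false = filterᵇ-absorb p q q⇒p xs
...   | true with () ← trans (sym px) (q⇒p x qx)


∈-*⁻ : ∀ φ F {D} → D ∈ φ * F
     → ∃[ E ] (E ∈ F × any (litSat φ) E ≡ false × D ≡ filterᵇ (litUnassigned φ) E)
∈-*⁻ φ (C ∷ F) D∈ with any (litSat φ) C in sat
∈-*⁻ φ (C ∷ F) D∈          | true  with E , E∈ , rest ← ∈-*⁻ φ F D∈ = E , there E∈ , rest
∈-*⁻ φ (C ∷ F) (here refl) | false = C , here refl , sat , refl
∈-*⁻ φ (C ∷ F) (there D∈)  | false with E , E∈ , rest ← ∈-*⁻ φ F D∈ = E , there E∈ , rest

∈-*⁺ : ∀ φ F {E} → E ∈ F → any (litSat φ) E ≡ false → filterᵇ (litUnassigned φ) E ∈ φ * F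
∈-*⁺ φ (C ∷ F) (here refl) unsat rewrite unsat = here refl
∈-*⁺ φ (C ∷ F) (there E∈)  unsat with any (litSat φ) C
... | true  = ∈-*⁺ φ F E∈ unsat
... | false = there (∈-*⁺ φ F E∈ unsat)

*≡[]⇒sat : ∀ φ F → φ * F ≡ [] → ∀ {E} → E ∈ F → any (litSat φ) E ≡ true
*≡[]⇒sat φ (C ∷ F) empty E∈ with any (litSat φ) C in sat
*≡[]⇒sat φ (C ∷ F) empty (here refl) | true = sat
*≡[]⇒sat φ (C ∷ F) empty (there E∈)  | true = *≡[]⇒sat φ F empty E∈
*≡[]⇒sat φ (C ∷ F) ()    E∈          | false

sat⇒*≡[] : ∀ φ F → (∀ {E} → E ∈ F → any (litSat φ) E ≡ true) → φ * F ≡ []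
sat⇒*≡[] φ []      sat = refl
sat⇒*≡[] φ (C ∷ F) sat rewrite sat (here refl) = sat⇒*≡[] φ F (sat ∘ there)

*-unassigned : ∀ φ F {D l} → D ∈ φ * F → l ∈ D → Unassigned φ (var l)
*-unassigned φ F {l = l} D∈ l∈ with E , _ , _ , refl ← ∈-*⁻ φ F D∈ =
  litUnassigned⇒look φ l (proj₂ (∈-filterᵇ⁻ (litUnassigned φ) {E} l∈))

*-IsClauseSet : ∀ φ F → IsClauseSet F → IsClauseSet (φ * F)
*-IsClauseSet φ F clauses D D∈ l l∈ ¬l∈ with E , E∈ , _ , refl ← ∈-*⁻ φ F D∈ =
  clauses E E∈ l (proj₁ (∈-filterᵇ⁻ (litUnassigned φ) {E} l∈))
                  (proj₁ (∈-filterᵇ⁻ (litUnassigned φ) {E} ¬l∈))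

⊑-any-litSat : ∀ {φ θ} → φ ⊑ θ → ∀ E → any (litSat φ) E ≡ true → any (litSat θ) E ≡ true
⊑-any-litSat {φ} {θ} φ⊑θ E sat with l , l∈ , l-sat ← any-true⁻ (litSat φ) E sat =
  any-true⁺ (litSat θ) l∈ (⊑-litSat φ⊑θ l l-sat)

⊑-any-litSat-false : ∀ {φ θ} → φ ⊑ θ → ∀ E → any (litSat θ) E ≡ false → any (litSat φ) E ≡ false
⊑-any-litSat-false {φ} φ⊑θ E unsat with any (litSat φ) E in sat
... | false = refl
... | true with () ← trans (sym unsat) (⊑-any-litSat φ⊑θ E sat)

⊑-any-litSat-filter : ∀ {ψ θ} → ψ ⊑ θ → ∀ E → any (litSat ψ) E ≡ false
                    → any (litSat θ) (filterᵇ (litUnassigned ψ) E) ≡ any (litSat θ) E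
⊑-any-litSat-filter ψ⊑θ [] _ = refl
⊑-any-litSat-filter {ψ} {θ} ψ⊑θ (l ∷ E) unsat with litSat ψ l in l-sat | litUnassigned ψ l in l-free
... | false | true = cong (litSat θ l ∨_) (⊑-any-litSat-filter ψ⊑θ E unsat)
... | false | false rewrite ⊑-litFalsified ψ⊑θ l l-sat l-free = ⊑-any-litSat-filter ψ⊑θ E unsat

⊑-*-absorb : ∀ {ψ θ} → ψ ⊑ θ → ∀ G → θ * (ψ * G) ≡ θ * G
⊑-*-absorb ψ⊑θ [] = refl
⊑-*-absorb {ψ} {θ} ψ⊑θ (C ∷ G) with any (litSat ψ) C in C-sat
... | true rewrite ⊑-any-litSat ψ⊑θ C C-sat = ⊑-*-absorb ψ⊑θ G
... | false rewrite ⊑-any-litSat-filter ψ⊑θ C C-sat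
                  | filterᵇ-absorb (litUnassigned ψ) (litUnassigned θ) (⊑-litUnassigned ψ⊑θ) C
                  | ⊑-*-absorb ψ⊑θ G = refl

any-litSat-[] : ∀ C → any (litSat []) C ≡ false
any-litSat-[] []      = refl
any-litSat-[] (_ ∷ C) = any-litSat-[] C

filterᵇ-litUnassigned-[] : ∀ C → filterᵇ (litUnassigned []) C ≡ C
filterᵇ-litUnassigned-[] []      = refl
filterᵇ-litUnassigned-[] (l ∷ C) = cong (l ∷_) (filterᵇ-litUnassigned-[] C)

[]-* : ∀ F → [] * F ≡ F
[]-* [] = refl
[]-* (C ∷ F) rewrite any-litSat-[] C | filterᵇ-litUnassigned-[] C = cong (C ∷_) ([]-* F)

-- Satisfiability

-- Any satisfying assignment α of θ * G combines with θ into one of G: keep θ and add α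
-- on the variables θ leaves free.
Unsat-* : ∀ G → Unsat G → ∀ θ → IsAssign θ → Unsat (θ * G)
Unsat-* G G-unsat θ θ-assign α α-assign α-sat = G-unsat β β-assign (sat⇒*≡[] β G β-sat)
  where
    W : List ℕ
    W = filter (Unassigned? θ) (dom α)
    β : Assign
    β = θ ++ (α ↾ W)
    θ⊥W : Disjoint (dom θ) W
    θ⊥W (v∈θ , v∈W) = unassigned⇒∉dom θ (proj₂ (∈-filter⁻ (Unassigned? θ) {xs = dom α} v∈W)) v∈θ
    β-assign : IsAssign β
    β-assign rewrite map-++ proj₁ θ (α ↾ W) | dom-↾ α W =
      Unique.++⁺ θ-assign (Unique.filter⁺ (Unassigned? θ) α-assign) θ⊥W
    β-sat : ∀ {E} → E ∈ G → any (litSat β) E ≡ true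
    β-sat {E} E∈ with any (litSat θ) E in θ-sat
    ... | true = ⊑-any-litSat (++-⊑ θ (α ↾ W)) E θ-sat
    ... | false with l , l∈ , l-sat ← any-true⁻ (litSat α) _ (*≡[]⇒sat α (θ * G) α-sat (∈-*⁺ θ G E∈ θ-sat))
                with l∈E , l-free ← ∈-filterᵇ⁻ (litUnassigned θ) {E} l∈ =
      any-true⁺ (litSat β) l∈E
        (look⇒litSat β l (trans (look-++ʳ θ (α ↾ W) θ-free) (litSat⇒look (α ↾ W) l α↾W-sat)))
      where
        θ-free : Unassigned θ (var l)
        θ-free = litUnassigned⇒look θ l l-free
        l-in-W : var l ∈ W
        l-in-W = ∈-filter⁺ (Unassigned? θ) (assigned⇒∈dom α (litSat⇒look α l l-sat)) θ-free
        α↾W-sat : litSat (α ↾ W) l ≡ true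
        α↾W-sat = ↾-litSat α W l-in-W l-sat

assignments : List ℕ → List Assign
assignments []      = [] ∷ []
assignments (v ∷ V) = map ((v , false) ∷_) (assignments V) ++ map ((v , true) ∷_) (assignments V)

dom-assignments : ∀ V {α} → α ∈ assignments V → dom α ≡ V
dom-assignments []      (here refl) = refl
dom-assignments (v ∷ V) α∈ with ∈-++⁻ (map ((v , false) ∷_) (assignments V)) α∈
... | inj₁ α∈₀ with β , β∈ , refl ← ∈-map⁻ ((v , false) ∷_) α∈₀ =
  cong (v ∷_) (dom-assignments V β∈)
... | inj₂ α∈₁ with β , β∈ , refl ← ∈-map⁻ ((v , true) ∷_) α∈₁ =
  cong (v ∷_) (dom-assignments V β∈)

↾∈assignments : ∀ φ V → φ ↾ V ∈ assignments V
↾∈assignments φ []      = here refl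
↾∈assignments φ (v ∷ V) with value φ v
... | false = ∈-++⁺ˡ (∈-map⁺ ((v , false) ∷_) (↾∈assignments φ V))
... | true  =
  ∈-++⁺ʳ (map ((v , false) ∷_) (assignments V)) (∈-map⁺ ((v , true) ∷_) (↾∈assignments φ V))

-- A satisfying assignment may be restricted to the variables of G, so it suffices to
-- try the finitely many assignments with domain V.
Unsat?-over : ∀ G V → Unique V → (∀ {E l} → E ∈ G → l ∈ E → var l ∈ V) → Dec (Unsat G)
Unsat?-over G V V-unique V-covers with any? (λ α → ≡-dec (≡-dec _≟ˡ_) (α * G) []) (assignments V)
... | yes ∃α with α , α∈ , α-sat ← find ∃α =
  no λ G-unsat → G-unsat α (subst Unique (sym (dom-assignments V α∈)) V-unique) α-sat
... | no ∄α =
  yes λ φ _ φ-sat → ∄α (lose (↾∈assignments φ V) (sat⇒*≡[] (φ ↾ V) G (↾-sat φ φ-sat)))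
  where
    ↾-sat : ∀ φ → φ * G ≡ [] → ∀ {E} → E ∈ G → any (litSat (φ ↾ V)) E ≡ true
    ↾-sat φ φ-sat {E} E∈ with l , l∈ , l-sat ← any-true⁻ (litSat φ) E (*≡[]⇒sat φ G φ-sat E∈) =
      any-true⁺ (litSat (φ ↾ V)) l∈ (↾-litSat φ V (V-covers E∈ l∈) l-sat)

vars : ClauseSet → List ℕ
vars []      = []
vars (C ∷ G) = map var C ++ vars G

var∈vars : ∀ G {E l} → E ∈ G → l ∈ E → var l ∈ vars G
var∈vars (C ∷ G) (here refl) l∈ = ∈-++⁺ˡ (∈-map⁺ var l∈)
var∈vars (C ∷ G) (there E∈)  l∈ = ∈-++⁺ʳ (map var C) (var∈vars G E∈ l∈)

Unsat? : ∀ G → Dec (Unsat G)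
Unsat? G = Unsat?-over G (deduplicate _≟_ (vars G)) (deduplicate-! (vars G))
                        (λ E∈ l∈ → ∈-deduplicate⁺ _≟_ (var∈vars G E∈ l∈))

-- Resolution trees

-- hts (node T₁ T₂ r) reduces to strahler (hts T₁) (hts T₂).
strahler : ℕ → ℕ → ℕ
strahler a b = if a ≡ᵇ b then suc a else a ⊔ b

strahler-≡ : ∀ a → strahler a a ≡ suc a
strahler-≡ a rewrite dec-true (a ≟ a) refl = refl

strahler-≢ : ∀ {a b} → a ≢ b → strahler a b ≡ a ⊔ b
strahler-≢ {a} {b} a≢b rewrite dec-false (a ≟ b) a≢b = refl

strahler-≥ˡ : ∀ a b → a ≤ strahler a b
strahler-≥ˡ a b with a ≟ b
... | yes refl rewrite strahler-≡ a = n≤1+n a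
... | no a≢b   rewrite strahler-≢ a≢b = m≤m⊔n a b

strahler-≥ʳ : ∀ a b → b ≤ strahler a b
strahler-≥ʳ a b with a ≟ b
... | yes refl rewrite strahler-≡ a = n≤1+n a
... | no a≢b   rewrite strahler-≢ a≢b = m≤n⊔m a b

strahler-≤-suc-⊔ : ∀ a b → strahler a b ≤ suc (a ⊔ b)
strahler-≤-suc-⊔ a b with a ≟ b
... | yes refl rewrite strahler-≡ a = s≤s (m≤m⊔n a a)
... | no a≢b   rewrite strahler-≢ a≢b = n≤1+n (a ⊔ b)

strahler-mono-≤ : ∀ {a b a′ b′} → a ≤ a′ → b ≤ b′ → strahler a b ≤ strahler a′ b′
strahler-mono-≤ {a} {b} {a′} {b′} a≤a′ b≤b′ with a ≟ b | a′ ≟ b′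
... | yes refl | yes refl rewrite strahler-≡ a | strahler-≡ a′ = s≤s a≤a′
... | no a≢b   | no a′≢b′ rewrite strahler-≢ a≢b | strahler-≢ a′≢b′ = ⊔-mono-≤ a≤a′ b≤b′
... | no a≢b   | yes refl rewrite strahler-≢ a≢b | strahler-≡ a′ =
  ≤-trans (⊔-lub a≤a′ b≤b′) (n≤1+n a′)
... | yes refl | no a′≢b′ rewrite strahler-≡ a | strahler-≢ a′≢b′ = ≰⇒> λ a′⊔b′≤a →
  a′≢b′ (trans (≤-antisym (m⊔n≤o⇒m≤o a′ b′ a′⊔b′≤a) a≤a′)
               (sym (≤-antisym (m⊔n≤o⇒n≤o a′ b′ a′⊔b′≤a) b≤b′)))

RTree⇒lits : ∀ {G C} (P : Lit → Set) → (∀ D → D ∈ G → ∀ l → l ∈ D → P l)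
           → RTree G C → ∀ l → l ∈ C → P l
RTree⇒lits P leaves (leaf (D , D∈ , C≈D)) l l∈ = leaves D D∈ l (to (C≈D l) l∈)
RTree⇒lits P leaves (node T₁ T₂ (_ , _ , _ , _ , R⇔)) l l∈ with proj₁ (to (R⇔ l) l∈)
... | inj₁ l∈C = RTree⇒lits P leaves T₁ l l∈C
... | inj₂ l∈D = RTree⇒lits P leaves T₂ l l∈D

RTree⇒ClashFree : ∀ {G C} → IsClauseSet G → RTree G C → ClashFree C
RTree⇒ClashFree clauses (leaf (D , D∈ , C≈D)) l l∈ ¬l∈ =
  clauses D D∈ l (to (C≈D l) l∈) (to (C≈D (neg l)) ¬l∈)
RTree⇒ClashFree clauses (node {D = D} T₁ T₂ (x , _ , _ , unique , R⇔)) l l∈ ¬l∈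
  with to (R⇔ l) l∈ | to (R⇔ (neg l)) ¬l∈
... | inj₁ l∈C , _         | inj₁ ¬l∈C , _ = RTree⇒ClashFree clauses T₁ l l∈C ¬l∈C
... | inj₂ l∈D , _         | inj₂ ¬l∈D , _ = RTree⇒ClashFree clauses T₂ l l∈D ¬l∈D
... | inj₁ l∈C , l≢x , _   | inj₂ ¬l∈D , _ = l≢x (unique l l∈C ¬l∈D)
... | inj₂ l∈D , _         | inj₁ ¬l∈C , ¬l≢x , _ =
  ¬l≢x (unique (neg l) ¬l∈C (subst (_∈ D) (sym (neg-involutive l)) l∈D))

unit-resolvent : ∀ x → Resolvent (x ∷ []) (neg x ∷ []) []
unit-resolvent x = x , here refl , here refl , unique , λ l → mk⇔ (λ ()) (resolved l)
  where
    unique : ∀ y → y ∈ x ∷ [] → neg y ∈ neg x ∷ [] → y ≡ x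
    unique y (here refl) _ = refl
    resolved : ∀ l → (l ∈ x ∷ [] ⊎ l ∈ neg x ∷ []) × l ≢ x × l ≢ neg x → l ∈ []
    resolved l (inj₁ (here refl) , l≢x , _)   = ⊥-elim (l≢x refl)
    resolved l (inj₂ (here refl) , _ , l≢¬x) = ⊥-elim (l≢¬x refl)

Refutation≤ : ClauseSet → ℕ → Set
Refutation≤ G m = Σ[ T ∈ Refutation G ] hts T ≤ m

Refutation≤-mono : ∀ {G m n} → m ≤ n → Refutation≤ G m → Refutation≤ G n
Refutation≤-mono m≤n (T , T≤m) = T , ≤-trans T≤m m≤n

extend : Lit → Bool → Clause → Clause
extend ℓ true  C = ℓ ∷ C
extend ℓ false C = C

∈-extend⁻ : ∀ {ℓ t C l} → l ∈ extend ℓ t C → (T t × l ≡ ℓ) ⊎ l ∈ C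
∈-extend⁻ {t = true}  (here l≡ℓ) = inj₁ (_ , l≡ℓ)
∈-extend⁻ {t = true}  (there l∈) = inj₂ l∈
∈-extend⁻ {t = false} l∈         = inj₂ l∈

∈-extend⁺ : ∀ {ℓ t C l} → l ∈ C → l ∈ extend ℓ t C
∈-extend⁺ {t = true}  l∈ = there l∈
∈-extend⁺ {t = false} l∈ = l∈

extend-∋ : ∀ {ℓ t C} → T t → ℓ ∈ extend ℓ t C
extend-∋ {t = true} _ = here refl

resolvent-extend : ∀ {ℓ C D R} t₁ t₂
                 → (∀ l → l ∈ C → var l ≢ var ℓ) → (∀ l → l ∈ D → var l ≢ var ℓ)
                 → Resolvent C D R → Resolvent (extend ℓ t₁ C) (extend ℓ t₂ D) (extend ℓ (t₁ ∨ t₂) R)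
resolvent-extend {ℓ} {C} {D} {R} t₁ t₂ C-avoids D-avoids (x , x∈C , ¬x∈D , unique , R⇔) =
  x , ∈-extend⁺ x∈C , ∈-extend⁺ ¬x∈D , unique′ , λ l → mk⇔ (extend-to l) (extend-from l)
  where
    ℓ≢x : ℓ ≢ x
    ℓ≢x refl = C-avoids ℓ x∈C refl
    ℓ≢¬x : ℓ ≢ neg x
    ℓ≢¬x refl = D-avoids (neg x) ¬x∈D refl
    unique′ : ∀ y → y ∈ extend ℓ t₁ C → neg y ∈ extend ℓ t₂ D → y ≡ x
    unique′ y y∈ ¬y∈ with ∈-extend⁻ {t = t₁} y∈ | ∈-extend⁻ {t = t₂} ¬y∈
    ... | inj₁ (_ , refl) | inj₁ (_ , ¬ℓ≡ℓ) = ⊥-elim (neg-≢ ℓ ¬ℓ≡ℓ)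
    ... | inj₁ (_ , refl) | inj₂ ¬ℓ∈D       = ⊥-elim (D-avoids (neg ℓ) ¬ℓ∈D refl)
    ... | inj₂ y∈C        | inj₁ (_ , ¬y≡ℓ) = ⊥-elim (C-avoids y y∈C (cong var ¬y≡ℓ))
    ... | inj₂ y∈C        | inj₂ ¬y∈D       = unique y y∈C ¬y∈D
    extend-to : ∀ l → l ∈ extend ℓ (t₁ ∨ t₂) R
              → (l ∈ extend ℓ t₁ C ⊎ l ∈ extend ℓ t₂ D) × l ≢ x × l ≢ neg x
    extend-to l l∈ with ∈-extend⁻ {t = t₁ ∨ t₂} l∈
    ... | inj₁ (t , refl) =
      [ (λ t → inj₁ (extend-∋ {t = t₁} t)) , (λ t → inj₂ (extend-∋ {t = t₂} t)) ]′
        (to (T-∨ {t₁} {t₂}) t) , ℓ≢x , ℓ≢¬x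
    ... | inj₂ l∈R with to (R⇔ l) l∈R
    ...   | l∈C⊎D , l≢x , l≢¬x =
      [ (λ l∈C → inj₁ (∈-extend⁺ l∈C)) , (λ l∈D → inj₂ (∈-extend⁺ l∈D)) ]′ l∈C⊎D ,
      l≢x , l≢¬x
    extend-from : ∀ l → (l ∈ extend ℓ t₁ C ⊎ l ∈ extend ℓ t₂ D) × l ≢ x × l ≢ neg x
                → l ∈ extend ℓ (t₁ ∨ t₂) R
    extend-from l (inj₁ l∈ , l≢x , l≢¬x) with ∈-extend⁻ {t = t₁} l∈
    ... | inj₁ (t , refl) = extend-∋ {t = t₁ ∨ t₂} (from (T-∨ {t₁} {t₂}) (inj₁ t))
    ... | inj₂ l∈C        = ∈-extend⁺ (from (R⇔ l) (inj₁ l∈C , l≢x , l≢¬x))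
    extend-from l (inj₂ l∈ , l≢x , l≢¬x) with ∈-extend⁻ {t = t₂} l∈
    ... | inj₁ (t , refl) = extend-∋ {t = t₁ ∨ t₂} (from (T-∨ {t₁} {t₂}) (inj₂ t))
    ... | inj₂ l∈D        = ∈-extend⁺ (from (R⇔ l) (inj₂ l∈D , l≢x , l≢¬x))

resolvent-⊆ : ∀ {C D R C′ D′} (r : Resolvent C D R) → C′ ⊆ C → D′ ⊆ D
            → proj₁ r ∈ C′ → neg (proj₁ r) ∈ D′ → ∃[ R′ ] (R′ ⊆ R × Resolvent C′ D′ R′)
resolvent-⊆ {R = R} {C′} {D′} (x , _ , _ , unique , R⇔) C′⊆C D′⊆D x∈C′ ¬x∈D′ =
  R′ , R′⊆R , x , x∈C′ , ¬x∈D′ , (λ y y∈ ¬y∈ → unique y (C′⊆C y∈) (D′⊆D ¬y∈)) ,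
  λ l → mk⇔ (R′-to l) (R′-from l)
  where
    off-pivot? : ∀ l → Dec (l ≢ x × l ≢ neg x)
    off-pivot? l = ¬? (l ≟ˡ x) ×-dec ¬? (l ≟ˡ neg x)
    R′ : Clause
    R′ = filter off-pivot? (C′ ++ D′)
    R′-to : ∀ l → l ∈ R′ → (l ∈ C′ ⊎ l ∈ D′) × l ≢ x × l ≢ neg x
    R′-to l l∈ with l∈C′++D′ , off-pivot ← ∈-filter⁻ off-pivot? {xs = C′ ++ D′} l∈ =
      ∈-++⁻ C′ l∈C′++D′ , off-pivot
    R′-from : ∀ l → (l ∈ C′ ⊎ l ∈ D′) × l ≢ x × l ≢ neg x → l ∈ R′
    R′-from l (l∈C′⊎D′ , off-pivot) =
      ∈-filter⁺ off-pivot? ([ ∈-++⁺ˡ , ∈-++⁺ʳ C′ ]′ l∈C′⊎D′) off-pivot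
    R′⊆R : R′ ⊆ R
    R′⊆R {l} l∈ with l∈C′⊎D′ , off-pivot ← R′-to l l∈ =
      from (R⇔ l) ([ (λ l∈C′ → inj₁ (C′⊆C l∈C′)) , (λ l∈D′ → inj₂ (D′⊆D l∈D′)) ]′ l∈C′⊎D′ ,
                   off-pivot)

-- Splitting and restriction

-- ℓ is the literal falsified by v ↦ b: lifting a derivation from ((v , b) ∷ χ) * F to χ * F
-- puts back the occurrences of ℓ that the reduct had deleted.
module Lift (F : ClauseSet) (v : ℕ) (b : Bool) (χ : Assign) (v-free : Unassigned χ v) where

  ψ : Assign
  ψ = (v , b) ∷ χ

  ℓ : Lit
  ℓ = lit v (not b)

  χ⊑ψ : χ ⊑ ψ
  χ⊑ψ = ∷-⊑ b v-free

  avoids-v : ∀ D → D ∈ ψ * F → ∀ l → l ∈ D → var l ≢ v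
  avoids-v D D∈ l l∈ = unassigned-≢ ψ (*-unassigned ψ F D∈ l∈) (look-here v b χ)

  unassigned-by-χ : ∀ {E l} → any (litSat ψ) E ≡ false → l ∈ E → litUnassigned χ l ≡ true
                  → l ≡ ℓ ⊎ litUnassigned ψ l ≡ true
  unassigned-by-χ {E} {l} ψ-unsat l∈E free with var l ≟ v
  ... | yes l-on-v =
    inj₁ (cong₂ lit l-on-v (litSat-false⇒≡not ψ l ψ-at-l (any-false⁻ (litSat ψ) ψ-unsat l∈E)))
    where
      ψ-at-l : look ψ (var l) ≡ just b
      ψ-at-l = trans (cong (look ψ) l-on-v) (look-here v b χ)
  ... | no l-off-v =
    inj₂ (look⇒litUnassigned ψ l (trans (look-there b χ l-off-v) (litUnassigned⇒look χ l free)))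

  leaf-lift : ∀ {C} → C ∈ᶜ (ψ * F) → ∃[ t ] extend ℓ t C ∈ᶜ (χ * F)
  leaf-lift {C} (D , D∈ , C≈D) with E , E∈ , ψ-unsat , refl ← ∈-*⁻ ψ F D∈ =
    does (ℓ ∈? E) , C′ , ∈-*⁺ χ F E∈ (⊑-any-litSat-false χ⊑ψ E ψ-unsat) , C≈C′
    where
      C′ : Clause
      C′ = filterᵇ (litUnassigned χ) E
      C⊆C′ : ∀ {l} → l ∈ C → l ∈ C′
      C⊆C′ {l} l∈C with l∈E , free ← ∈-filterᵇ⁻ (litUnassigned ψ) {E} (to (C≈D l) l∈C) =
        ∈-filterᵇ⁺ (litUnassigned χ) l∈E (⊑-litUnassigned χ⊑ψ l free)
      C′⊆ : ∀ {l} → l ∈ C′ → (l ≡ ℓ × ℓ ∈ E) ⊎ l ∈ C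
      C′⊆ {l} l∈C′ with l∈E , free ← ∈-filterᵇ⁻ (litUnassigned χ) {E} l∈C′ =
        [ (λ { refl → inj₁ (refl , l∈E) })
        , (λ freeψ → inj₂ (from (C≈D l) (∈-filterᵇ⁺ (litUnassigned ψ) l∈E freeψ))) ]′
        (unassigned-by-χ ψ-unsat l∈E free)
      C≈C′ : extend ℓ (does (ℓ ∈? E)) C ≈ᶜ C′
      C≈C′ l with ℓ ∈? E
      ... | yes ℓ∈E =
        mk⇔ (λ { (here refl) → ∈-filterᵇ⁺ (litUnassigned χ) ℓ∈E (look⇒litUnassigned χ ℓ v-free)
               ; (there l∈C) → C⊆C′ l∈C })
            ([ (λ (l≡ℓ , _) → here l≡ℓ) , there ]′ ∘ C′⊆)
      ... | no ℓ∉E =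
        mk⇔ C⊆C′ ([ (λ (_ , ℓ∈E) → ⊥-elim (ℓ∉E ℓ∈E)) , (λ l∈C → l∈C) ]′ ∘ C′⊆)

  lift : ∀ {C} (T : RTree (ψ * F) C) → ∃[ t ] Σ[ T′ ∈ RTree (χ * F) (extend ℓ t C) ] hts T′ ≡ hts T
  lift (leaf C∈) with t , C∈′ ← leaf-lift C∈ = t , leaf C∈′ , refl
  lift (node T₁ T₂ r) with t₁ , T₁′ , h₁ ← lift T₁ | t₂ , T₂′ , h₂ ← lift T₂ =
    t₁ ∨ t₂ ,
    node T₁′ T₂′ (resolvent-extend t₁ t₂ (RTree⇒lits _ avoids-v T₁) (RTree⇒lits _ avoids-v T₂) r) ,
    cong₂ strahler h₁ h₂

refute-by-splitting-on : ∀ F χ v → Unassigned χ v → ∀ m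
  → Refutation≤ (((v , false) ∷ χ) * F) m → Refutation≤ (((v , true) ∷ χ) * F) m
  → Refutation≤ (χ * F) (suc m)
refute-by-splitting-on F χ v v-free m (T₀ , T₀≤) (T₁ , T₁≤)
  with Lift.lift F v false χ v-free T₀ | Lift.lift F v true χ v-free T₁
... | false , T₀′ , h₀ | _ = T₀′ , ≤-trans (≤-reflexive h₀) (≤-trans T₀≤ (n≤1+n m))
... | true , _ | false , T₁′ , h₁ = T₁′ , ≤-trans (≤-reflexive h₁) (≤-trans T₁≤ (n≤1+n m))
... | true , T₀′ , h₀ | true , T₁′ , h₁ =
  node T₀′ T₁′ (unit-resolvent (lit v true)) ,
  ≤-trans (strahler-≤-suc-⊔ (hts T₀′) (hts T₁′))
          (s≤s (⊔-lub (≤-trans (≤-reflexive h₀) T₀≤) (≤-trans (≤-reflexive h₁) T₁≤)))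

refute-by-splitting : ∀ F k W → Unique W → ∀ χ → IsAssign χ → All (Unassigned χ) W
  → (∀ θ → IsAssign θ → All (Assigned θ) W → χ ⊑ θ → Refutation≤ (θ * F) k)
  → Refutation≤ (χ * F) (length W + k)
refute-by-splitting F k []      _                   χ χ-assign _                 leaves =
  leaves χ χ-assign [] ⊑-refl
refute-by-splitting F k (w ∷ W) (w∉W ∷ W-unique) χ χ-assign (w-free ∷ W-free) leaves =
  refute-by-splitting-on F χ w w-free (length W + k) (branch false) (branch true)
  where
    branch : ∀ b → Refutation≤ (((w , b) ∷ χ) * F) (length W + k)
    branch b = refute-by-splitting F k W W-unique ((w , b) ∷ χ) (∷-IsAssign b w-free χ-assign)
      (All.zipWith (λ (w≢u , u-free) → trans (look-there b χ (w≢u ∘ sym)) u-free) (w∉W , W-free))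
      λ θ θ-assign W-assigned ψ⊑θ →
        leaves θ θ-assign ((b , look-⊑ ψ⊑θ w b (look-here w b χ)) ∷ W-assigned)
               (⊑-trans (∷-⊑ b w-free) ψ⊑θ)

module Restrict (G : ClauseSet) (G-clauses : IsClauseSet G) (θ : Assign) where

  Restricted : Clause → ℕ → Set
  Restricted C h = (∃[ l ] (l ∈ C × litSat θ l ≡ true))
                 ⊎ (∃[ C′ ] (C′ ⊆ C × Σ[ T ∈ RTree (θ * G) C′ ] hts T ≤ h))

  derived-avoids : ∀ {C′ y} → RTree (θ * G) C′ → litSat θ y ≡ true → ∀ l → l ∈ C′ → var l ≢ var y
  derived-avoids T y-sat =
    RTree⇒lits _ (λ D D∈ l l∈ → unassigned-≢ θ (*-unassigned θ G D∈ l∈) (litSat⇒look θ _ y-sat)) T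

  restrict-node : ∀ {C D R h₁ h₂} → ClashFree C → ClashFree D → Resolvent C D R
                → Restricted C h₁ → Restricted D h₂ → Restricted R (strahler h₁ h₂)
  restrict-node {C} {D} {R} {h₁} {h₂} C-cf D-cf r@(x , x∈C , ¬x∈D , _ , R⇔) = go
    where
      off-pivotˡ : ∀ {l} → l ∈ C → l ≢ x → l ∈ R
      off-pivotˡ l∈ l≢x = from (R⇔ _) (inj₁ l∈ , l≢x , λ { refl → C-cf x x∈C l∈ })
      off-pivotʳ : ∀ {l} → l ∈ D → l ≢ neg x → l ∈ R
      off-pivotʳ l∈ l≢¬x = from (R⇔ _) (inj₂ l∈ , (λ { refl → D-cf x l∈ ¬x∈D }) , l≢¬x)
      go : Restricted C h₁ → Restricted D h₂ → Restricted R (strahler h₁ h₂)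
      go (inj₁ (l , l∈ , l-sat)) _ with l ≟ˡ x
      go (inj₁ (l , l∈ , l-sat)) _ | no l≢x = inj₁ (l , off-pivotˡ l∈ l≢x , l-sat)
      go (inj₁ (x , _ , x-sat)) (inj₁ (m , m∈ , m-sat)) | yes refl with m ≟ˡ neg x
      ... | yes refl  = ⊥-elim (litSat-neg θ x x-sat m-sat)
      ... | no  m≢¬x = inj₁ (m , off-pivotʳ m∈ m≢¬x , m-sat)
      go (inj₁ (x , _ , x-sat)) (inj₂ (D′ , D′⊆D , T₂ , T₂≤)) | yes refl =
        inj₂ (D′ , (λ l∈ → off-pivotʳ (D′⊆D l∈) λ { refl → derived-avoids T₂ x-sat _ l∈ refl }) ,
              T₂ , ≤-trans T₂≤ (strahler-≥ʳ h₁ h₂))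
      go (inj₂ (C′ , C′⊆C , T₁ , T₁≤)) (inj₁ (m , m∈ , m-sat)) with m ≟ˡ neg x
      ... | no  m≢¬x = inj₁ (m , off-pivotʳ m∈ m≢¬x , m-sat)
      ... | yes refl  =
        inj₂ (C′ , (λ l∈ → off-pivotˡ (C′⊆C l∈) λ { refl → derived-avoids T₁ m-sat _ l∈ refl }) ,
              T₁ , ≤-trans T₁≤ (strahler-≥ˡ h₁ h₂))
      go (inj₂ (C′ , C′⊆C , T₁ , T₁≤)) (inj₂ (D′ , D′⊆D , T₂ , T₂≤)) with x ∈? C′ | neg x ∈? D′
      ... | no x∉C′ | _ =
        inj₂ (C′ , (λ l∈ → off-pivotˡ (C′⊆C l∈) λ { refl → x∉C′ l∈ }) ,
              T₁ , ≤-trans T₁≤ (strahler-≥ˡ h₁ h₂))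
      ... | yes _ | no ¬x∉D′ =
        inj₂ (D′ , (λ l∈ → off-pivotʳ (D′⊆D l∈) λ { refl → ¬x∉D′ l∈ }) ,
              T₂ , ≤-trans T₂≤ (strahler-≥ʳ h₁ h₂))
      ... | yes x∈C′ | yes ¬x∈D′ with R′ , R′⊆R , r′ ← resolvent-⊆ r C′⊆C D′⊆D x∈C′ ¬x∈D′ =
        inj₂ (R′ , R′⊆R , node T₁ T₂ r′ , strahler-mono-≤ T₁≤ T₂≤)

  restrict : ∀ {C} (T : RTree G C) → Restricted C (hts T)
  restrict (leaf (D , D∈ , C≈D)) with any (litSat θ) D in D-sat
  ... | true with l , l∈ , l-sat ← any-true⁻ (litSat θ) D D-sat = inj₁ (l , from (C≈D l) l∈ , l-sat)
  ... | false =
    inj₂ (D′ , (λ {l} l∈ → from (C≈D l) (proj₁ (∈-filterᵇ⁻ (litUnassigned θ) {D} l∈))) ,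
          leaf (D′ , ∈-*⁺ θ G D∈ D-sat , λ _ → mk⇔ (λ l∈ → l∈) (λ l∈ → l∈)) , z≤n)
    where
      D′ : Clause
      D′ = filterᵇ (litUnassigned θ) D
  restrict (node T₁ T₂ r) =
    restrict-node (RTree⇒ClashFree G-clauses T₁) (RTree⇒ClashFree G-clauses T₂) r
                  (restrict T₁) (restrict T₂)

  restrict-refutation : ∀ {m} → Refutation≤ G m → Refutation≤ (θ * G) m
  restrict-refutation (T , T≤) with restrict T
  ... | inj₂ ([] , _ , T′ , T′≤) = T′ , ≤-trans T′≤ T≤
  ... | inj₂ (l ∷ _ , ⊆[] , _) with () ← ⊆[] (here refl)

HdLe-refutes : ∀ G k → IsClauseSet G → HdLe G k
             → ∀ θ → IsAssign θ → Unsat (θ * G) → Refutation≤ (θ * G) k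
HdLe-refutes G k G-clauses (hd-unsat , hd-sat) θ θ-assign θG-unsat with Unsat? G
... | yes G-unsat = Restrict.restrict-refutation G G-clauses θ (hd-unsat G-unsat)
... | no  G-sat   = hd-sat G-sat θ θ-assign θG-unsat

module _ (F : ClauseSet) (F-clauses : IsClauseSet F) (V : List ℕ) (V-unique : Unique V) (k : ℕ)
         (hd-V : ∀ ψ → IsAssign ψ → (∀ v → (v ∈ dom ψ) ⇔ (v ∈ V)) → HdLe (ψ * F) k) where

  refute-on-V : ∀ θ → IsAssign θ → All (Assigned θ) V → Unsat (θ * F) → Refutation≤ (θ * F) k
  refute-on-V θ θ-assign V-assigned θF-unsat =
    subst (λ G → Refutation≤ G k) θ↾V-absorbed
      (HdLe-refutes (θ ↾ V * F) k (*-IsClauseSet (θ ↾ V) F F-clauses)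
                    (hd-V (θ ↾ V) θ↾V-assign dom-θ↾V) θ θ-assign (subst Unsat (sym θ↾V-absorbed) θF-unsat))
    where
      θ↾V-absorbed : θ * (θ ↾ V * F) ≡ θ * F
      θ↾V-absorbed = ⊑-*-absorb (↾-⊑ θ V V-assigned) F
      θ↾V-assign : IsAssign (θ ↾ V)
      θ↾V-assign = subst Unique (sym (dom-↾ θ V)) V-unique
      dom-θ↾V : ∀ v → (v ∈ dom (θ ↾ V)) ⇔ (v ∈ V)
      dom-θ↾V v rewrite dom-↾ θ V = mk⇔ (λ v∈ → v∈) (λ v∈ → v∈)

  refute-reduct : ∀ φ → IsAssign φ → Unsat (φ * F) → Refutation≤ (φ * F) (length V + k)
  refute-reduct φ φ-assign φF-unsat =
    Refutation≤-mono (+-monoˡ-≤ k (length-filter (Unassigned? φ) V))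
      (refute-by-splitting F k W (Unique.filter⁺ (Unassigned? φ) V-unique) φ φ-assign
                           (all-filter (Unassigned? φ) V) refute-leaf)
    where
      W : List ℕ
      W = filter (Unassigned? φ) V
      refute-leaf : ∀ θ → IsAssign θ → All (Assigned θ) W → φ ⊑ θ → Refutation≤ (θ * F) k
      refute-leaf θ θ-assign W-assigned φ⊑θ =
        refute-on-V θ θ-assign (All.tabulate V-assigned)
          (subst Unsat (⊑-*-absorb φ⊑θ F) (Unsat-* (φ * F) φF-unsat θ θ-assign))
        where
          V-assigned : ∀ {v} → v ∈ V → Assigned θ v
          V-assigned {v} v∈ with look φ v in φ-at-v
          ... | just c  = c , look-⊑ φ⊑θ v c φ-at-v
          ... | nothing = All.lookup W-assigned (∈-filter⁺ (Unassigned? φ) v∈ φ-at-v)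

lemma4p3 : (F : ClauseSet) → IsClauseSet F
    → (V : List ℕ) → Unique V → (∀ v → v ∈ V → v ∈var F)
    → (k : ℕ)
    → (∀ ψ → IsAssign ψ → (∀ v → (v ∈ dom ψ) ⇔ (v ∈ V)) → HdLe (ψ * F) k)
    → HdLe F (length V + k)
lemma4p3 F F-clauses V V-unique _ k hd-V =
  (λ F-unsat → subst (λ G → Refutation≤ G (length V + k)) ([]-* F)
                     (refute-reduct F F-clauses V V-unique k hd-V [] [] (subst Unsat (sym ([]-* F)) F-unsat))) ,
  λ _ → refute-reduct F F-clauses V V-unique k hd-V
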